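{- Let $H$ be a $3$-graph on $n$ vertices, and let $0 < \epsilon < 1/2$. Then there exists an induced subgraph $G$ of $H$ such that (1) $v(G)\ge n^{1-\frac{2}{\log_2(1/\epsilon)}}$, and (2) $\Delta(G)\le \frac{d(G)}{\epsilon}$.
   Context: A $3$-graph is a hypergraph all of whose edges have size $3$. $v(G)$ is the number of vertices of $G$, $\Delta(G)$ its maximum degree, and $d(G)$ its average degree (the degree of a vertex being the number of edges containing it).
   Formalization: The parameter ε ranges only over the rationals with $0 < \epsilon < 1/2$. -}

module Defs where

open import Data.Nat using (ℕ; zero; suc; _+_; _*_; _∸_; _^_; _≤_; _<_; _⊔_)
open import Data.Fin using (Fin)
open import Data.Fin.Subset using (Subset; _∈_; _⊆_; ∣_∣)
open import Data.Fin.Subset.Properties using (_∈?_; _⊆?_)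
open import Data.List using (List; filter; length; map; foldr; allFin)
open import Data.Nat.ListAction using (sum)
open import Data.List.Relation.Unary.All using (All)
open import Data.List.Relation.Unary.Unique.Propositional using (Unique)
open import Data.Product using (_×_)
open import Data.Integer using () renaming (∣_∣ to absℤ)
open import Data.Rational using (ℚ; ↥_; ↧ₙ_)
open import Relation.Binary.PropositionalEquality using (_≡_)

record 3Graph (n : ℕ) : Set where
  field
    edges  : List (Subset n)
    size3  : All (λ e → ∣ e ∣ ≡ 3) edges
    simple : Unique edges
open 3Graph public

-- The induced subgraph H[S] is determined by its vertex set S.
-- Edges of H[S]: edges of H contained in S.
edgesIn : ∀ {n} → 3Graph n → Subset n → List (Subset n)
edgesIn H S = filter (λ e → e ⊆? S) (edges H)

verticesOf : ∀ {n} → Subset n → List (Fin n)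
verticesOf {n} S = filter (λ x → x ∈? S) (allFin n)

vInd : ∀ {n} → Subset n → ℕ
vInd S = ∣ S ∣

degInd : ∀ {n} → 3Graph n → Subset n → Fin n → ℕ
degInd H S x = length (filter (λ e → x ∈? e) (edgesIn H S))

-- Δ(H[S]) (0 for the empty graph)
maxDegInd : ∀ {n} → 3Graph n → Subset n → ℕ
maxDegInd H S = foldr _⊔_ 0 (map (degInd H S) (verticesOf S))

-- sum of degrees of H[S]; the average degree is d(H[S]) = degSumInd / vInd
degSumInd : ∀ {n} → 3Graph n → Subset n → ℕ
degSumInd H S = sum (map (degInd H S) (verticesOf S))

num : ℚ → ℕ
num ε = absℤ (↥ ε)

den : ℚ → ℕ
den ε = ↧ₙ ε

-- BigEnough n v ε  expresses the real inequality
--     v ≥ n ^ (1 - 2 / log₂ (1/ε))        (for n ≥ 1, 0 < ε < 1/2)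
-- in exact integer arithmetic. With θ = 1 - 2/log₂(1/ε) < 1 and ε = a/b:
-- for a nonnegative rational t = p/q (q > 0):  t < θ  ⟺  p < q and
-- 4^q · a^(q-p) < b^(q-p);  and (v a natural number, n ≥ 1)
-- v ≥ n^θ  ⟺  v ≥ 1 and v^q ≥ n^p for every such p/q < θ.
BigEnough : ℕ → ℕ → ℚ → Set
BigEnough n v ε =
  (1 ≤ v) ×
  (∀ p q → 0 < q → p < q →
     4 ^ q * num ε ^ (q ∸ p) < den ε ^ (q ∸ p) →
     n ^ p ≤ v ^ q)

-- Write ε = a/b and fix p < q with 4^q·ε^(q-p) < 1; put m = q - p, so that ε ≤ m/(4q).
-- Starting from the whole vertex set, repeatedly replace S by the set of vertices of
-- degree at most τ in H[S], choosing τ so that the potential |S|^(2q) / (Δ(S)+1)^m does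
-- not decrease. If no threshold τ < Δ(S) qualifies, a weighted AM-GM inequality shows
-- that for every τ at least a fraction (m/2q)·(Δ-τ)/(Δ+1) of the vertices have degree
-- above τ; summing over τ (layer-cake formula) gives Δ(S) ≤ (4q/m)·d(S) ≤ d(S)/ε, so S
-- is balanced. The final set T keeps the initial potential, and Δ(H)+1 ≤ n² yields
-- |T|^(2q) ≥ n^(2q-2m) = n^(2p). A largest balanced set therefore beats n^(p/q) for
-- every admissible p/q at once.
module Submission where

open import Level using (Level)
open import Function using (_∘_; id)
open import Data.Empty using (⊥; ⊥-elim)
open import Data.Bool using (Bool; true; false) renaming (_≟_ to _≟ᵇ_)
open import Data.Product using (∃; _×_; _,_; proj₁; proj₂; map₂; swap) renaming (map to map×)
open import Data.Sum using (_⊎_; [_,_]′; inj₁; inj₂)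
open import Data.Nat
open import Data.Nat.Properties
open import Data.Nat.Induction using (<-wellFounded)
open import Data.Nat.ListAction using (sum)
open import Data.Nat.Tactic.RingSolver using (solve-∀)
open import Data.Rational using (ℚ; 0ℚ; ½) renaming (_<_ to _<ℚ_)
open import Data.Fin using (Fin; zero; suc)
open import Data.Fin.Subset using (Subset; _∈_; _⊆_; ∣_∣; inside; outside; ⊤; ⁅_⁆)
open import Data.Fin.Subset.Properties
  using (_∈?_; _⊆?_; drop-there; ⊆-trans; p⊆q⇒∣p∣≤∣q∣; x∈p⇒∣p-x∣<∣p∣; ∣⁅x⁆∣≡1; ∣⊤∣≡n; ∣p∣≤n; anySubset?)
open import Data.Vec using ([]; _∷_; here; there)
import Data.Vec as Vec
open import Data.Vec.Properties using (lookup∘tabulate; []=⇒lookup; lookup⇒[]=)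
open import Data.List using (List; []; _∷_; [_]; filter; length; map; tabulate; allFin)
open import Data.List.Properties
  using (filter-++; length-++; filter-accept; filter-reject; filter-some; filter-none; foldr-preservesᵇ)
open import Data.List.Membership.Propositional using (lose)
open import Data.List.Membership.Propositional.Properties using (foldr-selective; ∈-map⁻)
open import Data.List.Relation.Unary.All using (All; []; _∷_)
import Data.List.Relation.Unary.All as All
import Data.List.Relation.Unary.All.Properties as All
open import Data.List.Relation.Unary.AllPairs using ([]; _∷_)
open import Data.List.Relation.Unary.Unique.Propositional using (Unique)
import Data.List.Relation.Unary.Unique.Propositional.Properties as Unique
import Data.List.Relation.Binary.Sublist.Propositional as Sublist
import Data.List.Relation.Binary.Sublist.Propositional.Properties as Sublist
open import Induction.WellFounded using (Acc; acc)
open import Relation.Binary.PropositionalEquality using (_≡_; refl; sym; trans; cong; subst; subst₂; module ≡-Reasoning)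
open import Relation.Nullary using (¬_; does; yes; no; contradiction)
open import Relation.Nullary.Decidable using (dec-true; _×-dec_)
open import Relation.Unary using (Pred; Decidable)
open import Relation.Unary.Properties using (∁?; _∩?_)
import Algebra.Properties.CommutativeSemigroup *-commutativeSemigroup as *-Comm
open *-Comm using () renaming (interchange to *-interchange)
open import Algebra.Properties.CommutativeSemigroup +-commutativeSemigroup using () renaming (interchange to +-interchange)

open import Defs

private variable
  ℓ ℓ₁ ℓ₂ : Level
  A : Set ℓ

^-distribʳ-* : ∀ m n o → (m * n) ^ o ≡ m ^ o * n ^ o
^-distribʳ-* m n zero    = refl
^-distribʳ-* m n (suc o) = begin
  m * n * (m * n) ^ o      ≡⟨ cong (m * n *_) (^-distribʳ-* m n o) ⟩
  m * n * (m ^ o * n ^ o)  ≡⟨ *-interchange m n (m ^ o) (n ^ o) ⟩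
  m * m ^ o * (n * n ^ o)  ∎
  where open ≡-Reasoning

am-gm₂ : ∀ x y → 2 * (x * y) ≤ x * x + y * y
am-gm₂ x y = [ ordered , flipped ]′ (≤-total x y)
  where
  ordered : ∀ {x y} → x ≤ y → 2 * (x * y) ≤ x * x + y * y
  ordered {x} x≤y with d , refl ← m≤n⇒∃[o]m+o≡n x≤y = begin
    2 * (x * (x + d))          ≤⟨ m≤m+n _ (d * d) ⟩
    2 * (x * (x + d)) + d * d  ≡⟨ square x d ⟩
    x * x + (x + d) * (x + d)  ∎
    where
    open ≤-Reasoning
    square : ∀ x d → 2 * (x * (x + d)) + d * d ≡ x * x + (x + d) * (x + d)
    square = solve-∀
  flipped : y ≤ x → 2 * (x * y) ≤ x * x + y * y
  flipped y≤x = subst₂ _≤_ (cong (2 *_) (*-comm y x)) (+-comm (y * y) (x * x)) (ordered y≤x)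

am-gm-pow : ∀ n x y → suc n * (x ^ n * y) ≤ y ^ suc n + n * x ^ suc n
am-gm-pow zero    x y = ≤-reflexive (base x y)
  where
  base : ∀ x y → 1 * (1 * y) ≡ y * 1 + 0
  base = solve-∀
am-gm-pow (suc n) x y = +-cancelʳ-≤ (n * (x * P * y)) _ _ (begin
  suc (suc n) * (x * P * y) + n * (x * P * y)  ≡⟨ e₁ n x P y ⟩
  suc n * P * (2 * (x * y))                     ≤⟨ *-monoʳ-≤ (suc n * P) (am-gm₂ x y) ⟩
  suc n * P * (x * x + y * y)                   ≡⟨ e₂ n x P y ⟩
  suc n * P * (x * x) + suc n * (P * y) * y     ≤⟨ +-monoʳ-≤ _ (*-monoˡ-≤ y (am-gm-pow n x y)) ⟩
  suc n * P * (x * x) + (Q + n * (x * P)) * y   ≡⟨ e₃ n x P y Q ⟩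
  y * Q + suc n * (x * (x * P)) + n * (x * P * y) ∎)
  where
  open ≤-Reasoning
  P = x ^ n
  Q = y ^ suc n
  e₁ : ∀ n x P y → suc (suc n) * (x * P * y) + n * (x * P * y) ≡ suc n * P * (2 * (x * y))
  e₁ = solve-∀
  e₂ : ∀ n x P y → suc n * P * (x * x + y * y) ≡ suc n * P * (x * x) + suc n * (P * y) * y
  e₂ = solve-∀
  e₃ : ∀ n x P y Q → suc n * P * (x * x) + (Q + n * (x * P)) * y ≡ y * Q + suc n * (x * (x * P)) + n * (x * P * y)
  e₃ = solve-∀

am-gm-step : ∀ r X D → suc r ^ suc r * (X ^ r * D) ≤ r ^ r * (X + D) ^ suc r
am-gm-step zero X D = subst₂ _≤_ (sym (e₁ D)) (sym (e₂ X D)) (m≤n+m D X)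
  where
  e₁ : ∀ D → 1 * 1 * (1 * D) ≡ D
  e₁ = solve-∀
  e₂ : ∀ X D → 1 * ((X + D) * 1) ≡ X + D
  e₂ = solve-∀
am-gm-step r@(suc _) X D = *-cancelˡ-≤ r (+-cancelʳ-≤ (r * (x * x^r)) _ _ (begin
  r * (suc r * c * (P * D)) + r * (x * x^r)  ≡⟨ e₁ r c P D X ⟩
  suc r * (x^r * y)                          ≤⟨ am-gm-pow-xy ⟩
  y * (ρ * Q) + r * (x * x^r)                ≡⟨ cong (_+ r * (x * x^r)) (e₂ r X D ρ Q) ⟩
  r * (ρ * ((X + D) * Q)) + r * (x * x^r)    ∎))
  where
  open ≤-Reasoning
  c = suc r ^ r
  P = X ^ r
  x^r = c * P
  Q = (X + D) ^ r
  ρ = r ^ r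
  x = suc r * X
  y = r * (X + D)
  -- At x = (1+r)X and y = r(X+D) both sides of am-gm-pow are r times those of the goal
  -- plus the same summand r·x^(1+r).
  am-gm-pow-xy : suc r * (x^r * y) ≤ y * (ρ * Q) + r * (x * x^r)
  am-gm-pow-xy = subst₂ (λ u v → suc r * (u * y) ≤ y * v + r * (x * u))
    (^-distribʳ-* (suc r) X r) (^-distribʳ-* r (X + D) r) (am-gm-pow r x y)
  e₁ : ∀ r c P D X → r * (suc r * c * (P * D)) + r * (suc r * X * (c * P)) ≡ suc r * (c * P * (r * (X + D)))
  e₁ = solve-∀
  e₂ : ∀ r X D ρ Q → r * (X + D) * (ρ * Q) ≡ r * (ρ * ((X + D) * Q))
  e₂ = solve-∀

n^n≢0 : ∀ n → NonZero (n ^ n)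
n^n≢0 zero    = _
n^n≢0 (suc n) = m^n≢0 (suc n) (suc n)

weighted-am-gm : ∀ s t x y → (s + t) ^ (s + t) * (x ^ s * y ^ t) ≤ (s * x + t * y) ^ (s + t)
weighted-am-gm s zero x y rewrite +-identityʳ s = ≤-reflexive (begin
  s ^ s * (x ^ s * 1)  ≡⟨ cong (s ^ s *_) (*-identityʳ (x ^ s)) ⟩
  s ^ s * x ^ s        ≡⟨ ^-distribʳ-* s x s ⟨
  (s * x) ^ s          ≡⟨ cong (_^ s) (+-identityʳ (s * x)) ⟨
  (s * x + 0) ^ s      ∎)
  where open ≡-Reasoning
weighted-am-gm s (suc t) x y rewrite +-suc s t =
  *-cancelˡ-≤ (r ^ r) {{n^n≢0 r}} (begin
    r ^ r * (suc r ^ suc r * (x ^ s * (y * y ^ t)))  ≡⟨ e₁ (r ^ r) (suc r ^ suc r) (x ^ s) (y ^ t) y ⟩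
    suc r ^ suc r * y * (r ^ r * (x ^ s * y ^ t))    ≤⟨ *-monoʳ-≤ (suc r ^ suc r * y) (weighted-am-gm s t x y) ⟩
    suc r ^ suc r * y * X ^ r                        ≡⟨ e₂ (suc r ^ suc r) y (X ^ r) ⟩
    suc r ^ suc r * (X ^ r * y)                      ≤⟨ am-gm-step r X y ⟩
    r ^ r * (X + y) ^ suc r                          ≡⟨ cong (λ z → r ^ r * z ^ suc r) (e₃ s x t y) ⟨
    r ^ r * (s * x + suc t * y) ^ suc r              ∎)
  where
  open ≤-Reasoning
  r = s + t
  X = s * x + t * y
  e₁ : ∀ ρ c P Q y → ρ * (c * (P * (y * Q))) ≡ c * y * (ρ * (P * Q))
  e₁ = solve-∀
  e₂ : ∀ c y Z → c * y * Z ≡ c * (Z * y)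
  e₂ = solve-∀
  e₃ : ∀ s x t y → s * x + suc t * y ≡ s * x + t * y + y
  e₃ = solve-∀

-- Weighted AM-GM of 2(n+1) and n with weights n and 2, whose mean is 2n.
[1+n]^n≤4*n^n : ∀ n → suc n ^ n ≤ 4 * n ^ n
[1+n]^n≤4*n^n zero        = s≤s z≤n
[1+n]^n≤4*n^n n@(suc _) =
  *-cancelˡ-≤ (2 ^ n) {{m^n≢0 2 n}} (*-cancelˡ-≤ (n ^ 2) {{m^n≢0 n 2}}
    (*-cancelˡ-≤ ((2 + n) ^ (2 + n)) {{m^n≢0 (2 + n) (2 + n)}} (begin
      (2 + n) ^ (2 + n) * (n ^ 2 * (2 ^ n * suc n ^ n))    ≡⟨ cong (λ z → c * (n ^ 2 * z)) (^-distribʳ-* 2 (suc n) n) ⟨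
      (2 + n) ^ (2 + n) * (n ^ 2 * (2 * suc n) ^ n)        ≤⟨ weighted-am-gm 2 n n (2 * suc n) ⟩
      (2 * n + n * (2 * suc n)) ^ (2 + n)                  ≡⟨ cong (_^ (2 + n)) (e₁ n) ⟩
      (2 * n * (2 + n)) ^ (2 + n)                          ≡⟨ ^-distribʳ-* (2 * n) (2 + n) (2 + n) ⟩
      (2 * n) ^ (2 + n) * (2 + n) ^ (2 + n)                ≡⟨ cong (_* (2 + n) ^ (2 + n)) (^-distribʳ-* 2 n (2 + n)) ⟩
      2 ^ (2 + n) * n ^ (2 + n) * (2 + n) ^ (2 + n)        ≡⟨ e₂ (2 ^ n) (n ^ n) n c ⟩
      (2 + n) ^ (2 + n) * (n ^ 2 * (2 ^ n * (4 * n ^ n)))  ∎)))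
  where
  open ≤-Reasoning
  c = (2 + n) ^ (2 + n)
  e₁ : ∀ n → 2 * n + n * (2 * suc n) ≡ 2 * n * (2 + n)
  e₁ = solve-∀
  e₂ : ∀ P Q n c → 2 * (2 * P) * (n * (n * Q)) * c ≡ c * (n * (n * 1) * (P * (4 * Q)))
  e₂ = solve-∀

m≤n⇒[1+n]^m≤4*n^m : ∀ {m n} → m ≤ n → suc n ^ m ≤ 4 * n ^ m
m≤n⇒[1+n]^m≤4*n^m {zero}      _   = s≤s z≤n
m≤n⇒[1+n]^m≤4*n^m {m@(suc _)} m≤n with u , refl ← m≤n⇒∃[o]m+o≡n m≤n =
  *-cancelˡ-≤ (N ^ u) {{m^n≢0 N u}} (begin
    N ^ u * suc N ^ m          ≤⟨ *-monoˡ-≤ (suc N ^ m) (^-monoˡ-≤ u (n≤1+n N)) ⟩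
    suc N ^ u * suc N ^ m      ≡⟨ *-comm (suc N ^ u) (suc N ^ m) ⟩
    suc N ^ m * suc N ^ u      ≡⟨ ^-distribˡ-+-* (suc N) m u ⟨
    suc N ^ N                  ≤⟨ [1+n]^n≤4*n^n N ⟩
    4 * N ^ N                  ≡⟨ cong (4 *_) (^-distribˡ-+-* N m u) ⟩
    4 * (N ^ m * N ^ u)        ≡⟨ e (N ^ m) (N ^ u) ⟩
    N ^ u * (4 * N ^ m)        ∎)
  where
  open ≤-Reasoning
  N = m + u
  e : ∀ x y → 4 * (x * y) ≡ y * (4 * x)
  e = solve-∀

[m+k]^m≤4^k*m^m : ∀ m k → (m + k) ^ m ≤ 4 ^ k * m ^ m
[m+k]^m≤4^k*m^m m zero    rewrite +-identityʳ m = m≤m+n (m ^ m) _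
[m+k]^m≤4^k*m^m m (suc k) rewrite +-suc m k = begin
  suc (m + k) ^ m      ≤⟨ m≤n⇒[1+n]^m≤4*n^m (m≤m+n m k) ⟩
  4 * (m + k) ^ m      ≤⟨ *-monoʳ-≤ 4 ([m+k]^m≤4^k*m^m m k) ⟩
  4 * (4 ^ k * m ^ m)  ≡⟨ *-assoc 4 (4 ^ k) (m ^ m) ⟨
  4 ^ suc k * m ^ m    ∎
  where open ≤-Reasoning

4^[k+m]*a^m<b^m⇒4*[k+m]*a≤m*b : ∀ k m {a b} → 4 ^ (k + m) * a ^ m < b ^ m → 4 * (k + m) * a ≤ m * b
4^[k+m]*a^m<b^m⇒4*[k+m]*a≤m*b k m {a} {b} small = ≮⇒≥ λ mb<4qa →
  <⇒≱ small (*-cancelˡ-≤ (m ^ m) {{n^n≢0 m}} (begin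
    m ^ m * b ^ m                      ≡⟨ ^-distribʳ-* m b m ⟨
    (m * b) ^ m                        ≤⟨ ^-monoˡ-≤ m (<⇒≤ mb<4qa) ⟩
    (4 * (k + m) * a) ^ m              ≡⟨ trans (^-distribʳ-* (4 * (k + m)) a m) (cong (_* a ^ m) (^-distribʳ-* 4 (k + m) m)) ⟩
    4 ^ m * (k + m) ^ m * a ^ m        ≡⟨ cong (λ z → 4 ^ m * z ^ m * a ^ m) (+-comm k m) ⟩
    4 ^ m * (m + k) ^ m * a ^ m        ≤⟨ *-monoˡ-≤ (a ^ m) (*-monoʳ-≤ (4 ^ m) ([m+k]^m≤4^k*m^m m k)) ⟩
    4 ^ m * (4 ^ k * m ^ m) * a ^ m    ≡⟨ e (4 ^ m) (4 ^ k) (m ^ m) (a ^ m) ⟩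
    m ^ m * (4 ^ k * 4 ^ m * a ^ m)    ≡⟨ cong (λ z → m ^ m * (z * a ^ m)) (^-distribˡ-+-* 4 k m) ⟨
    m ^ m * (4 ^ (k + m) * a ^ m)      ∎))
  where
  open ≤-Reasoning
  e : ∀ x y z w → x * (y * z) * w ≡ z * (y * x * w)
  e = solve-∀

-- With x = k/(k+j) and α = s/r this is x^α ≤ 1 - α(1 - x) ≤ N/(N+M), cleared of
-- denominators; the first step is the weighted AM-GM of k and k+j with weights s and r-s.
ratio-power-bound : ∀ {r s} k j N M .{{_ : NonZero (k + j)}} → s ≤ r →
  r * M * (k + j) ≤ s * (N + M) * j → (N + M) ^ r * k ^ s ≤ N ^ r * (k + j) ^ s
ratio-power-bound {s = s} k j N M s≤r hyp with t , refl ← m≤n⇒∃[o]m+o≡n s≤r =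
  *-cancelˡ-≤ (r ^ r * D ^ t) {{m*n≢0 (r ^ r) (D ^ t) {{n^n≢0 r}} {{m^n≢0 D t}}}} (begin
    r ^ r * D ^ t * (v ^ r * k ^ s)   ≡⟨ e₁ (r ^ r) (D ^ t) (v ^ r) (k ^ s) ⟩
    v ^ r * (r ^ r * (k ^ s * D ^ t)) ≤⟨ *-monoʳ-≤ (v ^ r) (weighted-am-gm s t k D) ⟩
    v ^ r * Y ^ r                     ≡⟨ ^-distribʳ-* v Y r ⟨
    (v * Y) ^ r                       ≤⟨ ^-monoˡ-≤ r vY≤rND ⟩
    (r * N * D) ^ r                   ≡⟨ trans (^-distribʳ-* (r * N) D r) (cong (_* D ^ r) (^-distribʳ-* r N r)) ⟩
    r ^ r * N ^ r * D ^ r             ≡⟨ cong (r ^ r * N ^ r *_) (^-distribˡ-+-* D s t) ⟩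
    r ^ r * N ^ r * (D ^ s * D ^ t)   ≡⟨ e₂ (r ^ r) (N ^ r) (D ^ s) (D ^ t) ⟩
    r ^ r * D ^ t * (N ^ r * D ^ s)   ∎)
  where
  open ≤-Reasoning
  r = s + t
  D = k + j
  v = N + M
  Y = s * k + t * D
  vY≤rND : v * Y ≤ r * N * D
  vY≤rND = +-cancelʳ-≤ (s * v * j) _ _ (begin
    v * Y + s * v * j      ≡⟨ e₃ N M s k t j ⟩
    r * N * D + r * M * D  ≤⟨ +-monoʳ-≤ (r * N * D) hyp ⟩
    r * N * D + s * v * j  ∎)
    where
    e₃ : ∀ N M s k t j → (N + M) * (s * k + t * (k + j)) + s * (N + M) * j ≡ (s + t) * N * (k + j) + (s + t) * M * (k + j)
    e₃ = solve-∀
  e₁ : ∀ ρ Dt vr ks → ρ * Dt * (vr * ks) ≡ vr * (ρ * (ks * Dt))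
  e₁ = solve-∀
  e₂ : ∀ ρ Nr Ds Dt → ρ * Nr * (Ds * Dt) ≡ ρ * Dt * (Nr * Ds)
  e₂ = solve-∀

n^k+n^[1+k]≤[1+n]^[1+k] : ∀ n k → n ^ k + n ^ suc k ≤ suc n ^ suc k
n^k+n^[1+k]≤[1+n]^[1+k] n k = *-monoʳ-≤ (suc n) (^-monoˡ-≤ k (n≤1+n n))

[1+n]²≥1+n² : ∀ n → suc (n ^ 2) ≤ suc n ^ 2
[1+n]²≥1+n² n = ≤-trans (s≤s (m≤m+n (n ^ 2) (2 * n))) (≤-reflexive (e n))
  where
  e : ∀ n → suc (n * (n * 1) + 2 * n) ≡ suc n * (suc n * 1)
  e = solve-∀

∑< : ℕ → (ℕ → ℕ) → ℕ
∑< zero    f = 0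
∑< (suc k) f = f k + ∑< k f

syntax ∑< k (λ τ → e) = ∑[ τ < k ] e

∑-mono-≤ : ∀ k {f g : ℕ → ℕ} → (∀ {τ} → τ < k → f τ ≤ g τ) → ∑< k f ≤ ∑< k g
∑-mono-≤ zero    _   = z≤n
∑-mono-≤ (suc k) f≤g = +-mono-≤ (f≤g ≤-refl) (∑-mono-≤ k (f≤g ∘ m≤n⇒m≤1+n))

∑-distrib-+ : ∀ k (f g : ℕ → ℕ) → ∑[ τ < k ] (f τ + g τ) ≡ ∑< k f + ∑< k g
∑-distrib-+ zero    f g = refl
∑-distrib-+ (suc k) f g = begin
  f k + g k + ∑[ τ < k ] (f τ + g τ)  ≡⟨ cong (f k + g k +_) (∑-distrib-+ k f g) ⟩
  f k + g k + (∑< k f + ∑< k g)       ≡⟨ +-interchange (f k) (g k) (∑< k f) (∑< k g) ⟩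
  f k + ∑< k f + (g k + ∑< k g)       ∎
  where open ≡-Reasoning

*-distribˡ-∑ : ∀ k c (f : ℕ → ℕ) → c * ∑< k f ≡ ∑[ τ < k ] (c * f τ)
*-distribˡ-∑ zero    c f = *-zeroʳ c
*-distribˡ-∑ (suc k) c f = trans (*-distribˡ-+ c (f k) (∑< k f)) (cong (c * f k +_) (*-distribˡ-∑ k c f))

2*∑[n+k∸τ]≡k*[2n+k+1] : ∀ n k → 2 * ∑[ τ < k ] (n + k ∸ τ) ≡ k * (2 * n + suc k)
2*∑[n+k∸τ]≡k*[2n+k+1] n zero    = refl
2*∑[n+k∸τ]≡k*[2n+k+1] n (suc k) = begin
  2 * (n + suc k ∸ k + ∑[ τ < k ] (n + suc k ∸ τ))  ≡⟨ cong (λ m → 2 * (m ∸ k + ∑[ τ < k ] (m ∸ τ))) (+-suc n k) ⟩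
  2 * (suc n + k ∸ k + ∑[ τ < k ] (suc n + k ∸ τ))  ≡⟨ cong (λ m → 2 * (m + S)) (m+n∸n≡m (suc n) k) ⟩
  2 * (suc n + S)                                   ≡⟨ *-distribˡ-+ 2 (suc n) S ⟩
  2 * suc n + 2 * S                                 ≡⟨ cong (2 * suc n +_) (2*∑[n+k∸τ]≡k*[2n+k+1] (suc n) k) ⟩
  2 * suc n + k * (2 * suc n + suc k)               ≡⟨ e n k ⟩
  suc k * (2 * n + suc (suc k))                     ∎
  where
  open ≡-Reasoning
  S = ∑[ τ < k ] (suc n + k ∸ τ)
  e : ∀ n k → 2 * suc n + k * (2 * suc n + suc k) ≡ suc k * (2 * n + suc (suc k))
  e = solve-∀

2*∑[k∸τ]≡k*[k+1] : ∀ k → 2 * ∑[ τ < k ] (k ∸ τ) ≡ k * suc k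
2*∑[k∸τ]≡k*[k+1] k = 2*∑[n+k∸τ]≡k*[2n+k+1] 0 k

length-filter-∷ : ∀ {P : Pred A ℓ} (P? : Decidable P) x xs →
  length (filter P? (x ∷ xs)) ≡ length (filter P? [ x ]) + length (filter P? xs)
length-filter-∷ P? x xs = trans (cong length (filter-++ P? [ x ] xs)) (length-++ (filter P? [ x ]))

length-filter-∁ : ∀ {P : Pred A ℓ} (P? : Decidable P) xs →
  length (filter P? xs) + length (filter (∁? P?) xs) ≡ length xs
length-filter-∁ P? []       = refl
length-filter-∁ P? (x ∷ xs) with does (P? x)
... | true  = cong suc (length-filter-∁ P? xs)
... | false = trans (+-suc _ _) (cong suc (length-filter-∁ P? xs))

module _ (f : A → ℕ) where

  private
    above? : ∀ τ → Decidable (λ x → ¬ f x ≤ τ)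
    above? τ = ∁? (λ x → f x ≤? τ)

  countAbove : List A → ℕ → ℕ
  countAbove xs τ = length (filter (above? τ) xs)

  ∑-countAbove-[x] : ∀ x k → ∑[ τ < k ] countAbove [ x ] τ ≡ f x ⊓ k
  ∑-countAbove-[x] x zero    = sym (⊓-zeroʳ (f x))
  ∑-countAbove-[x] x (suc k) with f x ≤? k
  ... | yes fx≤k = begin
    countAbove [ x ] k + ∑[ τ < k ] countAbove [ x ] τ
      ≡⟨ cong (λ l → length l + ∑[ τ < k ] countAbove [ x ] τ) (filter-reject (above? k) (λ fx≰k → fx≰k fx≤k)) ⟩
    ∑[ τ < k ] countAbove [ x ] τ                       ≡⟨ ∑-countAbove-[x] x k ⟩
    f x ⊓ k                                             ≡⟨ m≤n⇒m⊓n≡m fx≤k ⟩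
    f x                                                 ≡⟨ m≤n⇒m⊓n≡m (m≤n⇒m≤1+n fx≤k) ⟨
    f x ⊓ suc k                                         ∎
    where open ≡-Reasoning
  ... | no fx≰k = begin
    countAbove [ x ] k + ∑[ τ < k ] countAbove [ x ] τ
      ≡⟨ cong (λ l → length l + ∑[ τ < k ] countAbove [ x ] τ) (filter-accept (above? k) fx≰k) ⟩
    suc (∑[ τ < k ] countAbove [ x ] τ)                 ≡⟨ cong suc (∑-countAbove-[x] x k) ⟩
    suc (f x ⊓ k)                                       ≡⟨ cong suc (m≥n⇒m⊓n≡n (<⇒≤ (≰⇒> fx≰k))) ⟩
    suc k                                               ≡⟨ m≥n⇒m⊓n≡n (≰⇒> fx≰k) ⟨
    f x ⊓ suc k                                         ∎
    where open ≡-Reasoning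

  layer-cake : ∀ k xs → ∑[ τ < k ] countAbove xs τ ≤ sum (map f xs)
  layer-cake zero    []       = z≤n
  layer-cake (suc k) []       = layer-cake k []
  layer-cake k       (x ∷ xs) = begin
    ∑[ τ < k ] countAbove (x ∷ xs) τ
      ≤⟨ ∑-mono-≤ k (λ {τ} _ → ≤-reflexive (length-filter-∷ (above? τ) x xs)) ⟩
    ∑[ τ < k ] (countAbove [ x ] τ + countAbove xs τ)
      ≡⟨ ∑-distrib-+ k (countAbove [ x ]) (countAbove xs) ⟩
    ∑[ τ < k ] countAbove [ x ] τ + ∑[ τ < k ] countAbove xs τ
      ≤⟨ +-mono-≤ (≤-trans (≤-reflexive (∑-countAbove-[x] x k)) (m⊓n≤m (f x) k)) (layer-cake k xs) ⟩
    f x + sum (map f xs)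
      ∎
    where open ≤-Reasoning

length-All⊥ : ∀ {xs : List A} → All (λ _ → ⊥) xs → length xs ≤ 0
length-All⊥ [] = z≤n

filter-∩? : ∀ {P : Pred A ℓ₁} {Q : Pred A ℓ₂} (P? : Decidable P) (Q? : Decidable Q) xs →
  filter (P? ∩? Q?) xs ≡ filter Q? (filter P? xs)
filter-∩? P? Q? []       = refl
filter-∩? P? Q? (x ∷ xs) with does (P? x)
... | false = filter-∩? P? Q? xs
... | true  with does (Q? x)
...   | true  = cong (x ∷_) (filter-∩? P? Q? xs)
...   | false = filter-∩? P? Q? xs

descend : ∀ {P I : Pred A ℓ₁} (size : A → ℕ) →
  (∀ x → I x → P x ⊎ ∃ λ y → size y < size x × I y) → ∀ x → I x → ∃ λ y → P y × I y
descend {A = A} {P = P} {I = I} size step x Ix = go x Ix (<-wellFounded (size x))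
  where
  go : ∀ x → I x → Acc _<_ (size x) → ∃ λ y → P y × I y
  go x Ix (acc rec) with step x Ix
  ... | inj₁ Px             = x , Px , Ix
  ... | inj₂ (y , y<x , Iy) = go y Iy (rec y<x)

select : ∀ {n} {P : Pred (Fin n) ℓ} → Decidable P → Subset n
select P? = Vec.tabulate (λ x → does (P? x))

module _ {n} {P : Pred (Fin n) ℓ} (P? : Decidable P) where

  ∈-select⁺ : ∀ {x} → P x → x ∈ select P?
  ∈-select⁺ {x} px = lookup⇒[]= x (select P?) (trans (lookup∘tabulate _ x) (dec-true (P? x) px))

  ∈-select⁻ : ∀ {x} → x ∈ select P? → P x
  ∈-select⁻ {x} x∈ with P? x | trans (sym (lookup∘tabulate _ x)) ([]=⇒lookup x∈)
  ... | yes px | _ = px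

∣p∣≡length-filter-tabulate : ∀ {n} (p : Subset n) {P : Pred A ℓ} (P? : Decidable P) (f : Fin n → A) →
  (∀ {x} → P (f x) → x ∈ p) → (∀ {x} → x ∈ p → P (f x)) → ∣ p ∣ ≡ length (filter P? (tabulate f))
∣p∣≡length-filter-tabulate []            P? f to from = refl
∣p∣≡length-filter-tabulate (inside ∷ p)  P? f to from with P? (f zero)
... | yes _   = cong suc (∣p∣≡length-filter-tabulate p P? (f ∘ suc) (drop-there ∘ to) (from ∘ there))
... | no  ¬P₀ = ⊥-elim (¬P₀ (from here))
∣p∣≡length-filter-tabulate (outside ∷ p) P? f to from with P? (f zero)
... | yes P₀ with () ← to P₀
... | no  _   = ∣p∣≡length-filter-tabulate p P? (f ∘ suc) (drop-there ∘ to) (from ∘ there)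

∣p∣≡length-verticesOf : ∀ {n} (p : Subset n) → ∣ p ∣ ≡ length (verticesOf p)
∣p∣≡length-verticesOf p = ∣p∣≡length-filter-tabulate p (_∈? p) id id id

∣select∩∣≡length-filter-verticesOf : ∀ {n} (p : Subset n) {Q : Pred (Fin n) ℓ} (Q? : Decidable Q) →
  ∣ select ((_∈? p) ∩? Q?) ∣ ≡ length (filter Q? (verticesOf p))
∣select∩∣≡length-filter-verticesOf {n = n} p Q? = begin
  ∣ select p∩Q? ∣                        ≡⟨ ∣p∣≡length-filter-tabulate _ p∩Q? id (∈-select⁺ p∩Q?) (∈-select⁻ p∩Q?) ⟩
  length (filter p∩Q? (allFin n))        ≡⟨ cong length (filter-∩? (_∈? p) Q? (allFin n)) ⟩
  length (filter Q? (verticesOf p))      ∎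
  where
  open ≡-Reasoning
  p∩Q? = (_∈? p) ∩? Q?

largest : ∀ {n} {P : Pred (Subset n) ℓ₁} → Decidable P → ∀ S → P S →
  ∃ λ T → P T × (∀ U → P U → ∣ U ∣ ≤ ∣ T ∣)
largest {n = n} {P} P? S PS = map₂ swap (descend (λ T → n ∸ ∣ T ∣) step S PS)
  where
  step : ∀ T → P T → (∀ U → P U → ∣ U ∣ ≤ ∣ T ∣) ⊎ ∃ λ U → n ∸ ∣ U ∣ < n ∸ ∣ T ∣ × P U
  step T PT with anySubset? (λ U → P? U ×-dec (∣ T ∣ <? ∣ U ∣))
  ... | yes (U , PU , T<U) = inj₂ (U , ∸-monoʳ-< T<U (∣p∣≤n U) , PU)
  ... | no  none           = inj₁ (λ U PU → ≮⇒≥ (λ T<U → none (U , PU , T<U)))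

module _ {n : ℕ} where

  tails : Bool → List (Subset (suc n)) → List (Subset n)
  tails s []              = []
  tails s ((s′ ∷ t) ∷ es) with s ≟ᵇ s′
  ... | yes _ = t ∷ tails s es
  ... | no  _ = tails s es

  length-tails : ∀ es → length es ≡ length (tails inside es) + length (tails outside es)
  length-tails []                   = refl
  length-tails ((inside  ∷ t) ∷ es) = cong suc (length-tails es)
  length-tails ((outside ∷ t) ∷ es) = trans (cong suc (length-tails es)) (sym (+-suc _ _))

  length-tails-≤ : ∀ es {i o} → length (tails inside es) ≤ i → length (tails outside es) ≤ o → length es ≤ i + o
  length-tails-≤ es ins≤i outs≤o = ≤-trans (≤-reflexive (length-tails es)) (+-mono-≤ ins≤i outs≤o)

  All-tails : ∀ {P : Pred (Subset (suc n)) ℓ} {Q : Pred (Subset n) ℓ} s →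
    (∀ {t} → P (s ∷ t) → Q t) → ∀ {es} → All P es → All Q (tails s es)
  All-tails s P⇒Q {[]}             []         = []
  All-tails s P⇒Q {(s′ ∷ t) ∷ es} (pe ∷ pes) with s ≟ᵇ s′
  ... | yes refl = P⇒Q pe ∷ All-tails s P⇒Q pes
  ... | no  _    = All-tails s P⇒Q pes

  Unique-tails : ∀ s {es} → Unique es → Unique (tails s es)
  Unique-tails s {[]}             []         = []
  Unique-tails s {(s′ ∷ t) ∷ es} (e∉ ∷ ues) with s ≟ᵇ s′
  ... | yes refl = All-tails s (λ ≢ → ≢ ∘ cong (s ∷_)) e∉ ∷ Unique-tails s ues
  ... | no  _    = Unique-tails s ues

-- The crude bound n^k instead of a binomial coefficient suffices for Δ(H) < n².
length-unique-subsets : ∀ {n} k (es : List (Subset n)) → Unique es → All (λ e → ∣ e ∣ ≡ k) es → length es ≤ n ^ k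
length-unique-subsets {zero}  zero    []            _               _        = z≤n
length-unique-subsets {zero}  zero    (_ ∷ [])      _               _        = ≤-refl
length-unique-subsets {zero}  zero    ([] ∷ [] ∷ _) ((e≢e ∷ _) ∷ _) _        = ⊥-elim (e≢e refl)
length-unique-subsets {zero}  (suc k) []            _               _        = z≤n
length-unique-subsets {zero}  (suc k) ([] ∷ _)      _               (() ∷ _)
length-unique-subsets {suc n} zero    es            ues             sizes    = length-tails-≤ es
  (length-All⊥ (All-tails inside (λ ()) sizes))
  (length-unique-subsets zero _ (Unique-tails outside ues) (All-tails outside id sizes))
length-unique-subsets {suc n} (suc k) es            ues             sizes    = ≤-trans (length-tails-≤ es
  (length-unique-subsets k _ (Unique-tails inside ues) (All-tails inside suc-injective sizes))
  (length-unique-subsets (suc k) _ (Unique-tails outside ues) (All-tails outside id sizes)))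
  (n^k+n^[1+k]≤[1+n]^[1+k] n k)

length-unique-subsets-∋ : ∀ {n} k (x : Fin (suc n)) (es : List (Subset (suc n))) → Unique es →
  All (λ e → ∣ e ∣ ≡ suc k × x ∈ e) es → length es ≤ n ^ k
length-unique-subsets-∋ {n}     k       zero    es ues props = ≤-trans (length-tails-≤ es
  (length-unique-subsets k _ (Unique-tails inside ues) (All-tails inside (suc-injective ∘ proj₁) props))
  (length-All⊥ (All-tails outside (λ { (_ , ()) }) props)))
  (≤-reflexive (+-identityʳ (n ^ k)))
length-unique-subsets-∋ {suc n} zero    (suc x) es ues props = length-tails-≤ es
  (length-All⊥ (All-tails inside empty props))
  (length-unique-subsets-∋ zero x _ (Unique-tails outside ues) (All-tails outside (map₂ drop-there) props))
  where
  empty : ∀ {t} → ∣ inside ∷ t ∣ ≡ 1 × suc x ∈ inside ∷ t → ⊥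
  empty (size , x∈t) = n≮0 (≤-trans (x∈p⇒∣p-x∣<∣p∣ (drop-there x∈t)) (≤-reflexive (suc-injective size)))
length-unique-subsets-∋ {suc n} (suc k) (suc x) es ues props = ≤-trans (length-tails-≤ es
  (length-unique-subsets-∋ k x _ (Unique-tails inside ues) (All-tails inside (map× suc-injective drop-there) props))
  (length-unique-subsets-∋ (suc k) x _ (Unique-tails outside ues) (All-tails outside (map₂ drop-there) props)))
  (n^k+n^[1+k]≤[1+n]^[1+k] n k)

module _ {n} (H : 3Graph n) where

  -- Δ(S) ≤ d(S)/ε for ε = a/b, where d(S) = degSumInd H S / |S|.
  Balanced : ℕ → ℕ → Subset n → Set
  Balanced a b S = maxDegInd H S * a * ∣ S ∣ ≤ degSumInd H S * b

  degInd-mono : ∀ {S T} → T ⊆ S → ∀ x → degInd H T x ≤ degInd H S x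
  degInd-mono {S} {T} T⊆S x = Sublist.length-mono-≤
    (Sublist.filter⁺ (x ∈?_) (x ∈?_) (λ { refl → id })
      (Sublist.filter⁺ (_⊆? T) (_⊆? S) (λ { refl e⊆T → ⊆-trans e⊆T T⊆S }) (Sublist.⊆-refl {x = edges H})))

  maxDegInd≤ : ∀ {S τ} → (∀ {x} → x ∈ S → degInd H S x ≤ τ) → maxDegInd H S ≤ τ
  maxDegInd≤ {S} {τ} bound = foldr-preservesᵇ {P = _≤ τ} ⊔-lub z≤n
    (All.map⁺ (All.map bound (All.all-filter (_∈? S) (allFin n))))

  edgesIn-⁅x⁆ : ∀ x → edgesIn H ⁅ x ⁆ ≡ []
  edgesIn-⁅x⁆ x = filter-none (_⊆? ⁅ x ⁆) (All.map too-big (size3 H))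
    where
    too-big : ∀ {e} → ∣ e ∣ ≡ 3 → ¬ e ⊆ ⁅ x ⁆
    too-big {e} size e⊆x = <⇒≱ (s≤s (s≤s z≤n))
      (subst₂ _≤_ size (∣⁅x⁆∣≡1 x) (p⊆q⇒∣p∣≤∣q∣ {p = e} e⊆x))

  Balanced-⁅x⁆ : ∀ a b x → Balanced a b ⁅ x ⁆
  Balanced-⁅x⁆ a b x = subst (λ Δ → Δ * a * ∣ ⁅ x ⁆ ∣ ≤ degSumInd H ⁅ x ⁆ * b) (sym (n≤0⇒n≡0 Δ≤0)) z≤n
    where
    Δ≤0 : maxDegInd H ⁅ x ⁆ ≤ 0
    Δ≤0 = maxDegInd≤ λ {y} _ → ≤-reflexive (cong (length ∘ filter (y ∈?_)) (edgesIn-⁅x⁆ x))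

  Balanced? : ∀ a b → Decidable (Balanced a b)
  Balanced? a b S = maxDegInd H S * a * ∣ S ∣ ≤? degSumInd H S * b

  light? : ∀ S τ → Decidable (λ x → degInd H S x ≤ τ)
  light? S τ x = degInd H S x ≤? τ

  low : Subset n → ℕ → Subset n
  low S τ = select ((_∈? S) ∩? light? S τ)

  heavy : Subset n → ℕ → ℕ
  heavy S τ = countAbove (degInd H S) (verticesOf S) τ

  maxDegInd-low≤ : ∀ S τ → maxDegInd H (low S τ) ≤ τ
  maxDegInd-low≤ S τ = maxDegInd≤ λ {x} x∈low →
    ≤-trans (degInd-mono (proj₁ ∘ ∈-select⁻ S∩light?) x) (proj₂ (∈-select⁻ S∩light? x∈low))
    where S∩light? = (_∈? S) ∩? light? S τ

  ∣low∣+heavy≡∣S∣ : ∀ S τ → ∣ low S τ ∣ + heavy S τ ≡ ∣ S ∣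
  ∣low∣+heavy≡∣S∣ S τ = begin
    ∣ low S τ ∣ + heavy S τ
      ≡⟨ cong (_+ heavy S τ) (∣select∩∣≡length-filter-verticesOf S (light? S τ)) ⟩
    length (filter (light? S τ) (verticesOf S)) + heavy S τ
      ≡⟨ length-filter-∁ (light? S τ) (verticesOf S) ⟩
    length (verticesOf S)
      ≡⟨ ∣p∣≡length-verticesOf S ⟨
    ∣ S ∣
      ∎
    where open ≡-Reasoning

  heavy>0 : ∀ S {τ} → τ < maxDegInd H S → 0 < heavy S τ
  heavy>0 S {τ} τ<Δ with foldr-selective ⊔-sel 0 (map (degInd H S) (verticesOf S))
  ... | inj₁ Δ≡0 = contradiction (≤-trans (≤-reflexive Δ≡0) z≤n) (<⇒≱ τ<Δ)
  ... | inj₂ Δ∈  with x , x∈V , Δ≡deg ← ∈-map⁻ (degInd H S) Δ∈ =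
    filter-some (∁? (light? S τ)) (lose x∈V (λ deg≤τ → <⇒≱ τ<Δ (subst (_≤ τ) (sym Δ≡deg) deg≤τ)))

  ∣low∣<∣S∣ : ∀ S {τ} → τ < maxDegInd H S → ∣ low S τ ∣ < ∣ S ∣
  ∣low∣<∣S∣ S {τ} τ<Δ = begin-strict
    ∣ low S τ ∣               ≡⟨ +-identityʳ _ ⟨
    ∣ low S τ ∣ + 0           <⟨ +-monoʳ-< (∣ low S τ ∣) (heavy>0 S τ<Δ) ⟩
    ∣ low S τ ∣ + heavy S τ   ≡⟨ ∣low∣+heavy≡∣S∣ S τ ⟩
    ∣ S ∣                     ∎
    where open ≤-Reasoning

  ∑heavy≤degSumInd : ∀ S k → ∑[ τ < k ] heavy S τ ≤ degSumInd H S
  ∑heavy≤degSumInd S k = layer-cake (degInd H S) k (verticesOf S)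

degInd≤n² : ∀ {n} (H : 3Graph (suc n)) S x → degInd H S x ≤ n ^ 2
degInd≤n² H S x = ≤-trans
  (Sublist.length-mono-≤ (Sublist.filter⁺ (x ∈?_) (x ∈?_) (λ { refl → id }) (Sublist.filter-⊆ (_⊆? S) (edges H))))
  (length-unique-subsets-∋ 2 x _ (Unique.filter⁺ (x ∈?_) (simple H))
    (All.zip (All.filter⁺ (x ∈?_) (size3 H) , All.all-filter (x ∈?_) (edges H))))

1+maxDegInd≤[1+n]² : ∀ {n} (H : 3Graph (suc n)) S → suc (maxDegInd H S) ≤ suc n ^ 2
1+maxDegInd≤[1+n]² {n} H S = ≤-trans (s≤s (maxDegInd≤ H (λ {x} _ → degInd≤n² H S x))) ([1+n]²≥1+n² n)

module Peeling {n} (H : 3Graph n) (a b p m : ℕ) .{{_ : NonZero m}} (4qa≤mb : 4 * (p + m) * a ≤ m * b) where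

  private
    Δ : Subset n → ℕ
    Δ = maxDegInd H

  R : ℕ
  R = (p + m) * 2

  -- The potential of S is |S|^R / (Δ(S)+1)^m. Cutting S at τ is profitable if the
  -- potential of low S τ, computed with τ in place of its maximum degree, is not smaller;
  -- the invariant says that the potential stays at least that of the whole vertex set.
  Profitable : Subset n → ℕ → Set
  Profitable S τ = ∣ S ∣ ^ R * suc τ ^ m ≤ ∣ low H S τ ∣ ^ R * suc (Δ S) ^ m

  Invariant : Subset n → Set
  Invariant S = n ^ R * suc (Δ S) ^ m ≤ ∣ S ∣ ^ R * suc (Δ ⊤) ^ m

  unprofitable⇒heavy : ∀ S {τ} → τ < Δ S → ¬ Profitable S τ → m * ∣ S ∣ * (Δ S ∸ τ) ≤ R * suc (Δ S) * heavy H S τ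
  unprofitable⇒heavy S {τ} τ<Δ unprofitable =
    ≤-trans (<⇒≤ (≰⇒> (unprofitable ∘ profitable))) (≤-reflexive (*-Comm.xy∙z≈xz∙y R (heavy H S τ) (suc (Δ S))))
    where
    N = ∣ low H S τ ∣
    M = heavy H S τ
    j = Δ S ∸ τ
    N+M≡∣S∣ : N + M ≡ ∣ S ∣
    N+M≡∣S∣ = ∣low∣+heavy≡∣S∣ H S τ
    1+τ+j≡1+Δ : suc τ + j ≡ suc (Δ S)
    1+τ+j≡1+Δ = cong suc (m+[n∸m]≡n (<⇒≤ τ<Δ))
    m≤R : m ≤ R
    m≤R = ≤-trans (m≤n+m m p) (m≤m*n (p + m) 2)
    profitable : R * M * suc (Δ S) ≤ m * ∣ S ∣ * j → Profitable S τ
    profitable le = subst₂ (λ v D → v ^ R * suc τ ^ m ≤ N ^ R * D ^ m) N+M≡∣S∣ 1+τ+j≡1+Δ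
      (ratio-power-bound (suc τ) j N M m≤R
        (subst₂ (λ v D → R * M * D ≤ m * v * j) (sym N+M≡∣S∣) (sym 1+τ+j≡1+Δ) le))

  balanced-if-unprofitable : ∀ S → (∀ {τ} → τ < Δ S → ¬ Profitable S τ) → Balanced H a b S
  balanced-if-unprofitable S none = *-cancelˡ-≤ (4 * (p + m)) {{m*n≢0 4 (p + m) {{_}} {{q≢0}}}} (begin
    4 * (p + m) * (D * a * v)  ≡⟨ e₁ (4 * (p + m)) D a v ⟩
    4 * (p + m) * a * (v * D)  ≤⟨ *-monoˡ-≤ (v * D) 4qa≤mb ⟩
    m * b * (v * D)            ≡⟨ e₂ m b v D ⟩
    b * (m * v * D)            ≤⟨ *-monoʳ-≤ b mvD≤4qΣ ⟩
    b * (4 * (p + m) * Σ)      ≡⟨ *-comm b _ ⟩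
    4 * (p + m) * Σ * b        ≡⟨ *-assoc (4 * (p + m)) Σ b ⟩
    4 * (p + m) * (Σ * b)      ∎)
    where
    open ≤-Reasoning
    D = Δ S
    v = ∣ S ∣
    Σ = degSumInd H S
    q≢0 : NonZero (p + m)
    q≢0 = >-nonZero (≤-trans (>-nonZero⁻¹ m) (m≤n+m m p))
    summed : m * v * ∑[ τ < D ] (D ∸ τ) ≤ R * suc D * Σ
    summed = begin
      m * v * ∑[ τ < D ] (D ∸ τ)            ≡⟨ *-distribˡ-∑ D (m * v) (D ∸_) ⟩
      ∑[ τ < D ] (m * v * (D ∸ τ))          ≤⟨ ∑-mono-≤ D (λ τ<D → unprofitable⇒heavy S τ<D (none τ<D)) ⟩
      ∑[ τ < D ] (R * suc D * heavy H S τ)  ≡⟨ *-distribˡ-∑ D (R * suc D) (heavy H S) ⟨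
      R * suc D * ∑[ τ < D ] heavy H S τ    ≤⟨ *-monoʳ-≤ (R * suc D) (∑heavy≤degSumInd H S D) ⟩
      R * suc D * Σ                          ∎
    mvD≤4qΣ : m * v * D ≤ 4 * (p + m) * Σ
    mvD≤4qΣ = *-cancelˡ-≤ (suc D) (begin
      suc D * (m * v * D)              ≡⟨ e₁ D (m * v) ⟩
      m * v * (D * suc D)              ≡⟨ cong (m * v *_) (2*∑[k∸τ]≡k*[k+1] D) ⟨
      m * v * (2 * ∑[ τ < D ] (D ∸ τ)) ≡⟨ *-Comm.x∙yz≈y∙xz (m * v) 2 _ ⟩
      2 * (m * v * ∑[ τ < D ] (D ∸ τ)) ≤⟨ *-monoʳ-≤ 2 summed ⟩
      2 * (R * suc D * Σ)              ≡⟨ e₂ p m D Σ ⟩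
      suc D * (4 * (p + m) * Σ)        ∎)
      where
      e₁ : ∀ D x → suc D * (x * D) ≡ x * (D * suc D)
      e₁ = solve-∀
      e₂ : ∀ p m D s → 2 * ((p + m) * 2 * suc D * s) ≡ suc D * (4 * (p + m) * s)
      e₂ = solve-∀
    e₁ : ∀ c D a v → c * (D * a * v) ≡ c * a * (v * D)
    e₁ = solve-∀
    e₂ : ∀ m b v D → m * b * (v * D) ≡ b * (m * v * D)
    e₂ = solve-∀

  Invariant-low : ∀ S {τ} → Invariant S → Profitable S τ → Invariant (low H S τ)
  Invariant-low S {τ} inv profitable = *-cancelˡ-≤ dS {{m^n≢0 (suc (Δ S)) m}} (begin
    dS * (n ^ R * suc (Δ T) ^ m)  ≤⟨ *-monoʳ-≤ dS (*-monoʳ-≤ (n ^ R) (^-monoˡ-≤ m (s≤s (maxDegInd-low≤ H S τ)))) ⟩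
    dS * (n ^ R * dτ)              ≡⟨ *-Comm.x∙yz≈yx∙z dS (n ^ R) dτ ⟩
    n ^ R * dS * dτ                ≤⟨ *-monoˡ-≤ dτ inv ⟩
    ∣ S ∣ ^ R * d⊤ * dτ            ≡⟨ *-Comm.xy∙z≈y∙xz (∣ S ∣ ^ R) d⊤ dτ ⟩
    d⊤ * (∣ S ∣ ^ R * dτ)          ≤⟨ *-monoʳ-≤ d⊤ profitable ⟩
    d⊤ * (∣ T ∣ ^ R * dS)          ≡⟨ *-Comm.x∙yz≈z∙yx d⊤ (∣ T ∣ ^ R) dS ⟩
    dS * (∣ T ∣ ^ R * d⊤)          ∎)
    where
    open ≤-Reasoning
    T = low H S τ
    dS = suc (Δ S) ^ m
    d⊤ = suc (Δ ⊤) ^ m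
    dτ = suc τ ^ m

  Invariant-⊤ : Invariant ⊤
  Invariant-⊤ = ≤-reflexive (cong (λ v → v ^ R * suc (Δ ⊤) ^ m) (sym (∣⊤∣≡n n)))

  peel-step : ∀ S → Invariant S → Balanced H a b S ⊎ ∃ λ T → ∣ T ∣ < ∣ S ∣ × Invariant T
  peel-step S inv with anyUpTo? (λ τ → ∣ S ∣ ^ R * suc τ ^ m ≤? ∣ low H S τ ∣ ^ R * suc (Δ S) ^ m) (Δ S)
  ... | yes (τ , τ<Δ , profitable) = inj₂ (low H S τ , ∣low∣<∣S∣ H S τ<Δ , Invariant-low S inv profitable)
  ... | no  none                   = inj₁ (balanced-if-unprofitable S λ τ<Δ profitable → none (_ , τ<Δ , profitable))

  Invariant⇒large : ∀ .{{_ : NonZero n}} → suc (Δ ⊤) ≤ n ^ 2 → ∀ T → Invariant T → n ^ p ≤ ∣ T ∣ ^ (p + m)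
  Invariant⇒large Δ⊤<n² T inv = ≮⇒≥ λ small → <⇒≱ (^-monoˡ-< 2 small) squares
    where
    open ≤-Reasoning
    v = ∣ T ∣
    squares : (n ^ p) ^ 2 ≤ (v ^ (p + m)) ^ 2
    squares = *-cancelʳ-≤ _ _ (n ^ (m * 2)) {{m^n≢0 n (m * 2)}} (begin
      (n ^ p) ^ 2 * n ^ (m * 2)          ≡⟨ cong (_* n ^ (m * 2)) (^-*-assoc n p 2) ⟩
      n ^ (p * 2) * n ^ (m * 2)          ≡⟨ ^-distribˡ-+-* n (p * 2) (m * 2) ⟨
      n ^ (p * 2 + m * 2)                ≡⟨ cong (n ^_) (*-distribʳ-+ 2 p m) ⟨
      n ^ R                              ≤⟨ m≤m*n (n ^ R) (suc (Δ T) ^ m) {{m^n≢0 (suc (Δ T)) m}} ⟩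
      n ^ R * suc (Δ T) ^ m              ≤⟨ inv ⟩
      v ^ R * suc (Δ ⊤) ^ m              ≤⟨ *-monoʳ-≤ (v ^ R) (^-monoˡ-≤ m Δ⊤<n²) ⟩
      v ^ R * (n ^ 2) ^ m                ≡⟨ cong (v ^ R *_) (trans (^-*-assoc n 2 m) (cong (n ^_) (*-comm 2 m))) ⟩
      v ^ R * n ^ (m * 2)                ≡⟨ cong (_* n ^ (m * 2)) (^-*-assoc v (p + m) 2) ⟨
      (v ^ (p + m)) ^ 2 * n ^ (m * 2)    ∎)

  peel : ∀ .{{_ : NonZero n}} → suc (Δ ⊤) ≤ n ^ 2 → ∃ λ T → Balanced H a b T × n ^ p ≤ ∣ T ∣ ^ (p + m)
  peel Δ⊤<n² with T , balanced , inv ← descend ∣_∣ peel-step ⊤ Invariant-⊤ = T , balanced , Invariant⇒large Δ⊤<n² T inv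

large-balanced-subset : ∀ {n} (H : 3Graph (suc n)) a b p q → p < q → 4 ^ q * a ^ (q ∸ p) < b ^ (q ∸ p) →
  ∃ λ T → Balanced H a b T × suc n ^ p ≤ ∣ T ∣ ^ q
large-balanced-subset H a b p q p<q small with m , refl ← m≤n⇒∃[o]m+o≡n (<⇒≤ p<q) =
  Peeling.peel H a b p m {{m≢0}} (4^[k+m]*a^m<b^m⇒4*[k+m]*a≤m*b p m small′) (1+maxDegInd≤[1+n]² H ⊤)
  where
  m≢0 : NonZero m
  m≢0 = >-nonZero (+-cancelˡ-< p 0 m (subst (_< p + m) (sym (+-identityʳ p)) p<q))
  small′ : 4 ^ (p + m) * a ^ m < b ^ m
  small′ = subst (λ k → 4 ^ (p + m) * a ^ k < b ^ k) (m+n∸m≡n p m) small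

lemma8 : (n : ℕ) (H : 3Graph n) (ε : ℚ) → 1 ≤ n → 0ℚ <ℚ ε → ε <ℚ ½ →
    ∃ λ (S : Subset n) →
    BigEnough n (vInd S) ε ×
    maxDegInd H S * num ε * vInd S ≤ degSumInd H S * den ε
lemma8 zero    H ε () _ _
lemma8 (suc n) H ε _ _ _
  with S , balanced , maximal ← largest (Balanced? H (num ε) (den ε)) ⁅ zero ⁆ (Balanced-⁅x⁆ H (num ε) (den ε) zero) =
  S , (1≤∣S∣ , large) , balanced
  where
  1≤∣S∣ : 1 ≤ ∣ S ∣
  1≤∣S∣ = subst (_≤ ∣ S ∣) (∣⁅x⁆∣≡1 (zero {n})) (maximal ⁅ zero ⁆ (Balanced-⁅x⁆ H (num ε) (den ε) zero))
  large : ∀ p q → 0 < q → p < q → 4 ^ q * num ε ^ (q ∸ p) < den ε ^ (q ∸ p) → suc n ^ p ≤ ∣ S ∣ ^ q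
  large p q _ p<q small with T , T-balanced , T-large ← large-balanced-subset H (num ε) (den ε) p q p<q small =
    ≤-trans T-large (^-monoˡ-≤ q (maximal T T-balanced))
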